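{- Let $\mathcal{S}\subseteq\{0,1\}^n$ be a set of vectors such that for every $i\in[n]$ there exist $v,w\in\mathcal{S}$ with $v_i=1$ and $w_i=0$. A vector $v\in\{0,1\}^n$ belongs to $Cl_{S_{12}}(\mathcal{S})$ if and only if (1) there exists $w\in\mathcal{S}$ with $\mathbb{1}(v)\subseteq\mathbb{1}(w)$, and (2) for all $(k,i)\in\mathbb{1}(v)\times\mathbb{0}(v)$ there exists $w\in\mathcal{S}$ with $(w_k,w_i)=(0,1)$ or $(w_k,w_i)=(1,0)$.
   Context: For $v\in\{0,1\}^n$, $\mathbb{1}(v)=\{i\mid v_i=1\}$ and $\mathbb{0}(v)=\{i\mid v_i=0\}$. Boolean operations act on vectors coordinate-wise. $S_{12}$ is the clone generated by the ternary operation $x\wedge(y\to z)$, and $Cl_{S_{12}}(\mathcal{S})$ is the smallest set of vectors containing $\mathcal{S}$ and closed under $(x,y,z)\mapsto x\wedge(y\to z)$ (applied coordinate-wise). -}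

module Defs where

open import Data.Bool using (Bool; true; false; _∧_; _∨_; not)
open import Data.Nat using (ℕ)
open import Data.Fin using (Fin)
open import Data.Vec using (Vec; zipWith; lookup)
open import Data.Product using (_×_)
open import Data.Sum using (_⊎_)
open import Relation.Binary.PropositionalEquality using (_≡_)
open import Level using (Level; _⊔_; suc)

_⇒ᵇ_ : Bool → Bool → Bool
y ⇒ᵇ z = not y ∨ z

s12op : {n : ℕ} → Vec Bool n → Vec Bool n → Vec Bool n → Vec Bool n
s12op x y z = zipWith _∧_ x (zipWith _⇒ᵇ_ y z)

data Cl {ℓ : Level} {n : ℕ} (S : Vec Bool n → Set ℓ) : Vec Bool n → Set ℓ where
  base : ∀ {v} → S v → Cl S v
  step : ∀ {x y z} → Cl S x → Cl S y → Cl S z → Cl S (s12op x y z)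

OnesSubset : {n : ℕ} → Vec Bool n → Vec Bool n → Set
OnesSubset v w = ∀ i → lookup v i ≡ true → lookup w i ≡ true

-- Writing x ⊓ y = x ∧ (x → y) and x ∖ y = x ∧ (y → 0), the closure is closed under
-- meets and, once it contains the zero vector, under differences. Soundness: both
-- conditions are inherited by x ∧ (y → z) from x, y and z, since 1(x ∧ (y → z)) ⊆ 1(x)
-- and a coordinate pair on which x ∧ (y → z) differs is one on which x, y or z differs.
-- Completeness: meets of vectors of S give 0; for i ∈ 0(v) a meet of separators gives m_i
-- with m_i(i) = 1 and m_i = 0 on 1(v); and v is the meet of w and all w ∖ m_i, where w ∈ S
-- covers 1(v).
module Submission where

open import Defs
open import Data.Bool using (Bool; true; false; _∧_; _∨_; not)
open import Data.Bool.Properties using (∧-conicalˡ; ∧-zeroʳ; ∨-identityʳ) renaming (_≟_ to _≟ᵇ_)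
open import Data.Nat using (ℕ)
open import Data.Fin using (Fin)
open import Data.List using (List; []; _∷_; allFin)
open import Data.List.Membership.Propositional using (_∈_)
open import Data.List.Membership.Propositional.Properties using (∈-allFin)
open import Data.List.Relation.Unary.Any using (here; there)
open import Data.Product using (Σ; ∃; _×_; _,_; proj₁; proj₂)
open import Data.Sum using (_⊎_; inj₁; inj₂)
open import Data.Vec using (Vec; lookup; zipWith)
open import Data.Vec.Properties using (lookup-zipWith)
open import Data.Vec.Relation.Binary.Pointwise.Extensional using (ext; Pointwise-≡⇒≡)
open import Function.Bundles using (_⇔_; mk⇔)
open import Level using (Level)
open import Relation.Nullary using (yes; no; contradiction)
open import Relation.Unary using (Pred; Decidable; U; ∅)
open import Relation.Unary.Properties using (U?)
open import Relation.Binary.PropositionalEquality using (_≡_; _≢_; refl; sym; trans; cong; cong₂; subst; module ≡-Reasoning)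

private
  variable
    ℓ p t : Level
    n : ℕ

lookup-s12op : (x y z : Vec Bool n) (i : Fin n) →
               lookup (s12op x y z) i ≡ lookup x i ∧ (lookup y i ⇒ᵇ lookup z i)
lookup-s12op x y z i =
  trans (lookup-zipWith _∧_ i x _) (cong (lookup x i ∧_) (lookup-zipWith _⇒ᵇ_ i y z))

differing-argument : (f : Bool → Bool → Bool → Bool) {x x′ y y′ z z′ : Bool} →
                     f x y z ≢ f x′ y′ z′ → x ≢ x′ ⊎ y ≢ y′ ⊎ z ≢ z′
differing-argument f {x} {x′} {y} {y′} {z} {z′} d with x ≟ᵇ x′ | y ≟ᵇ y′ | z ≟ᵇ z′
... | no x≢x′ | _        | _        = inj₁ x≢x′
... | yes _   | no y≢y′  | _        = inj₂ (inj₁ y≢y′)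
... | yes _   | yes _    | no z≢z′  = inj₂ (inj₂ z≢z′)
... | yes refl | yes refl | yes refl = contradiction refl d

≢-opposite : {a b : Bool} → a ≢ b → (a ≡ false × b ≡ true) ⊎ (a ≡ true × b ≡ false)
≢-opposite {false} {false} a≢b = contradiction refl a≢b
≢-opposite {false} {true}  _   = inj₁ (refl , refl)
≢-opposite {true}  {false} _   = inj₂ (refl , refl)
≢-opposite {true}  {true}  a≢b = contradiction refl a≢b

Covers : Pred (Fin n) t → Vec Bool n → Set t
Covers T c = ∀ j → T j → lookup c j ≡ true

VanishesOn : Pred (Fin n) p → Vec Bool n → Set p
VanishesOn P c = ∀ j → P j → lookup c j ≡ false

_⊓_ : Vec Bool n → Vec Bool n → Vec Bool n
x ⊓ y = s12op x x y

lookup-⊓ : (x y : Vec Bool n) (i : Fin n) → lookup (x ⊓ y) i ≡ lookup x i ∧ lookup y i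
lookup-⊓ x y i = trans (lookup-s12op x x y i) (absorb (lookup x i) (lookup y i))
  where
  absorb : ∀ a b → a ∧ (a ⇒ᵇ b) ≡ a ∧ b
  absorb false b = refl
  absorb true  b = refl

determined-by-ones : {c v : Vec Bool n} → Covers (λ j → lookup v j ≡ true) c →
                     VanishesOn (λ j → lookup v j ≡ false) c → c ≡ v
determined-by-ones {c = c} {v} ones zeros = Pointwise-≡⇒≡ (ext agree)
  where
  agree : ∀ j → lookup c j ≡ lookup v j
  agree j with lookup v j in vj
  ... | true  = ones j vj
  ... | false = zeros j vj

module _ (S : Vec Bool n → Set ℓ) where

  Cl-rec : (P : Pred (Vec Bool n) p) → (∀ {v} → S v → P v) →
           (∀ {x y z} → P x → P y → P z → P (s12op x y z)) →
           ∀ {v} → Cl S v → P v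
  Cl-rec P P-base P-step (base s)          = P-base s
  Cl-rec P P-base P-step (step cx cy cz) =
    P-step (Cl-rec P P-base P-step cx) (Cl-rec P P-base P-step cy) (Cl-rec P P-base P-step cz)

  Bounded : Vec Bool n → Set ℓ
  Bounded v = ∃ λ w → S w × OnesSubset v w

  Cl-bounded : ∀ {v} → Cl S v → Bounded v
  Cl-bounded = Cl-rec Bounded (λ {v} s → v , s , λ _ vi → vi) λ {x} {y} {z} → bounded-step {x} {y} {z}
    where
    bounded-step : ∀ {x y z} → Bounded x → Bounded y → Bounded z → Bounded (s12op x y z)
    bounded-step {x} {y} {z} (w , s , x⊆w) _ _ =
      w , s , λ i vi → x⊆w i (∧-conicalˡ _ _ (trans (sym (lookup-s12op x y z i)) vi))

  Separated : Vec Bool n → Set ℓ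
  Separated v = ∀ k i → lookup v k ≢ lookup v i → ∃ λ w → S w × lookup w k ≢ lookup w i

  Cl-separated : ∀ {v} → Cl S v → Separated v
  Cl-separated = Cl-rec Separated (λ {v} s k i d → v , s , d) λ {x} {y} {z} → separated-step {x} {y} {z}
    where
    separated-step : ∀ {x y z} → Separated x → Separated y → Separated z →
                     Separated (s12op x y z)
    separated-step {x} {y} {z} sx sy sz k i d
      with differing-argument (λ a b c → a ∧ (b ⇒ᵇ c))
             (λ e → d (trans (lookup-s12op x y z k) (trans e (sym (lookup-s12op x y z i)))))
    ... | inj₁ dx        = sx k i dx
    ... | inj₂ (inj₁ dy) = sy k i dy
    ... | inj₂ (inj₂ dz) = sz k i dz

  Cl-⊓ : ∀ {x y} → Cl S x → Cl S y → Cl S (x ⊓ y)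
  Cl-⊓ cx cy = step cx cx cy

  Cl-meet-vanishing : (T : Pred (Fin n) t) {P : Pred (Fin n) p} → Decidable P →
    (∃ λ a → Cl S a × Covers T a) →
    (∀ j → P j → ∃ λ b → Cl S b × Covers T b × lookup b j ≡ false) →
    ∃ λ c → Cl S c × Covers T c × VanishesOn P c
  Cl-meet-vanishing T {P} P? (a , ca , Ta) vanishers =
    let c , cc , Tc , Pc = meet-over (allFin _) in c , cc , Tc , λ j → Pc j (∈-allFin j)
    where
    meet-over : (L : List (Fin _)) →
                ∃ λ c → Cl S c × Covers T c × (∀ j → j ∈ L → P j → lookup c j ≡ false)
    meet-over [] = a , ca , Ta , λ _ ()
    meet-over (j ∷ L) with meet-over L | P? j
    ... | c , cc , Tc , Lc | no ¬Pj = c , cc , Tc , vanishes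
      where
      vanishes : ∀ j′ → j′ ∈ j ∷ L → P j′ → lookup c j′ ≡ false
      vanishes _ (here refl) Pj = contradiction Pj ¬Pj
      vanishes j′ (there j′∈L) = Lc j′ j′∈L
    ... | c , cc , Tc , Lc | yes Pj =
      let b , cb , Tb , bj = vanishers j Pj in c ⊓ b , Cl-⊓ cc cb , covers b Tb , vanishes b bj
      where
      covers : ∀ b → Covers T b → Covers T (c ⊓ b)
      covers b Tb j′ Tj′ = trans (lookup-⊓ c b j′) (cong₂ _∧_ (Tc j′ Tj′) (Tb j′ Tj′))
      vanishes : ∀ b → lookup b j ≡ false → ∀ j′ → j′ ∈ j ∷ L → P j′ → lookup (c ⊓ b) j′ ≡ false
      vanishes b bj _ (here refl) _ =
        trans (lookup-⊓ c b j) (trans (cong (lookup c j ∧_) bj) (∧-zeroʳ (lookup c j)))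
      vanishes b bj j′ (there j′∈L) Pj′ = trans (lookup-⊓ c b j′) (cong (_∧ _) (Lc j′ j′∈L Pj′))

module Completeness (S : Vec Bool n → Set ℓ)
  (hyp : ∀ i → (Σ (Vec Bool n) λ u → S u × lookup u i ≡ true)
             × (Σ (Vec Bool n) λ u → S u × lookup u i ≡ false))
  {v w : Vec Bool n} (s : S w) (v⊆w : OnesSubset v w)
  (sep : ∀ k i → lookup v k ≡ true → lookup v i ≡ false →
         Σ (Vec Bool n) λ u → S u × ((lookup u k ≡ false × lookup u i ≡ true)
                                     ⊎ (lookup u k ≡ true × lookup u i ≡ false)))
  where

  zero-vector : ∃ λ z → Cl S z × VanishesOn U z
  zero-vector =
    let z , cz , _ , z-vanishes =
          Cl-meet-vanishing S ∅ U? (w , base s , λ _ ())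
            λ j _ → let u , su , uj = proj₂ (hyp j) in u , base su , (λ _ ()) , uj
    in z , cz , z-vanishes

  𝟎 : Vec Bool n
  𝟎 = proj₁ zero-vector

  _∖_ : Vec Bool n → Vec Bool n → Vec Bool n
  x ∖ y = s12op x y 𝟎

  Cl-∖ : ∀ {x y} → Cl S x → Cl S y → Cl S (x ∖ y)
  Cl-∖ cx cy = step cx cy (proj₁ (proj₂ zero-vector))

  lookup-∖ : (x y : Vec Bool n) (i : Fin n) → lookup (x ∖ y) i ≡ lookup x i ∧ not (lookup y i)
  lookup-∖ x y i = begin
    lookup (x ∖ y) i                        ≡⟨ lookup-s12op x y 𝟎 i ⟩
    lookup x i ∧ (lookup y i ⇒ᵇ lookup 𝟎 i) ≡⟨ cong (λ b → lookup x i ∧ (lookup y i ⇒ᵇ b)) 𝟎-vanishes ⟩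
    lookup x i ∧ (not (lookup y i) ∨ false) ≡⟨ cong (lookup x i ∧_) (∨-identityʳ _) ⟩
    lookup x i ∧ not (lookup y i)           ∎
    where
    open ≡-Reasoning
    𝟎-vanishes : lookup 𝟎 i ≡ false
    𝟎-vanishes = proj₂ (proj₂ zero-vector) i _

  separator : ∀ k i → lookup v k ≡ true → lookup v i ≡ false →
              ∃ λ t → Cl S t × lookup t k ≡ false × lookup t i ≡ true
  separator k i vk vi with sep k i vk vi
  ... | u , su , inj₁ (uk , ui) = u , base su , uk , ui
  ... | u , su , inj₂ (uk , ui) =
    let p , sp , pi = proj₁ (hyp i)
    in p ∖ u , Cl-∖ (base sp) (base su)
     , trans (lookup-∖ p u k) (trans (cong (λ b → lookup p k ∧ not b) uk) (∧-zeroʳ _))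
     , trans (lookup-∖ p u i) (cong₂ (λ a b → a ∧ not b) pi ui)

  excluding : ∀ i → lookup v i ≡ false →
              ∃ λ u → Cl S u × Covers (λ j → lookup v j ≡ true) u × lookup u i ≡ false
  excluding i vi =
    let p , sp , pi = proj₁ (hyp i)
        m , cm , m-covers , m-vanishes =
          Cl-meet-vanishing S (_≡ i) (λ k → lookup v k ≟ᵇ true) (p , base sp , λ { _ refl → pi })
            λ k vk → let t , ct , tk , ti = separator k i vk vi in t , ct , (λ { _ refl → ti }) , tk
    in w ∖ m , Cl-∖ (base s) cm
     , (λ j vj → trans (lookup-∖ w m j) (cong₂ (λ a b → a ∧ not b) (v⊆w j vj) (m-vanishes j vj)))
     , trans (lookup-∖ w m i) (trans (cong (λ b → lookup w i ∧ not b) (m-covers i refl)) (∧-zeroʳ _))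

  v∈Cl : Cl S v
  v∈Cl =
    let c , cc , c-covers , c-vanishes =
          Cl-meet-vanishing S (λ j → lookup v j ≡ true) (λ j → lookup v j ≟ᵇ false)
            (w , base s , v⊆w) excluding
    in subst (Cl S) (determined-by-ones c-covers c-vanishes) cc

theorem4 : (n : ℕ) (S : Vec Bool n → Set) →
    (∀ (i : Fin n) → (Σ (Vec Bool n) λ v → S v × lookup v i ≡ true)
                   × (Σ (Vec Bool n) λ w → S w × lookup w i ≡ false)) →
    (v : Vec Bool n) →
    Cl S v ⇔
      ((Σ (Vec Bool n) λ w → S w × OnesSubset v w)
       × (∀ (k i : Fin n) → lookup v k ≡ true → lookup v i ≡ false →
            Σ (Vec Bool n) λ w → S w ×
              ((lookup w k ≡ false × lookup w i ≡ true)
               ⊎ (lookup w k ≡ true × lookup w i ≡ false))))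
theorem4 n S hyp v = mk⇔
  (λ cv → Cl-bounded S cv , λ k i vk vi →
    let w , s , w-differs = Cl-separated S cv k i λ e → contradiction (trans (sym vk) (trans e vi)) λ ()
    in w , s , ≢-opposite w-differs)
  λ { ((w , s , v⊆w) , sep) → Completeness.v∈Cl S hyp s v⊆w sep }
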